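{- Let $G$ be a cubic graph on $n \ge 8$ vertices that has a self-identifying code. If $x \in V(G)$ is not adjacent to a triangle not containing itself, then there exists $y \in B_2(x)$ such that $y$ is not adjacent to a triangle not containing itself and $y$ is not a twin.
   Context: All graphs are finite, simple, undirected and connected; a cubic graph is 3-regular. $N(v)$ is the open and $N[v] = N(v) \cup \{v\}$ the closed neighborhood; $N_S[v] = N[v] \cap S$. A set $S \subseteq V(G)$ is a self-identifying code (SIC) if for every $x \in V(G)$, $N_S[x] \neq \varnothing$ and $\bigcap_{v \in N_S[x]} N[v] = \{x\}$. $B_2(x) = \{v : d(x,v) \le 2\}$. A vertex $v$ is adjacent to a triangle not containing itself if there are vertices $a,b,c$ forming a triangle with $v \notin \{a,b,c\}$ and $va \in E(G)$. A vertex $y$ is a twin if there is a vertex $y' \neq y$ with $N[y'] = N[y]$ or $N(y') = N(y)$. -}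

module Defs where

open import Data.Nat using (ℕ; _≤_)
open import Data.Fin using (Fin)
open import Data.Bool using (Bool; true)
open import Data.Product using (Σ; ∃; ∃-syntax; _×_; _,_)
open import Data.Sum using (_⊎_)
open import Relation.Nullary using (¬_; Dec)
open import Relation.Binary.PropositionalEquality using (_≡_; _≢_)

record Graph (n : ℕ) : Set₁ where
  field
    Adj     : Fin n → Fin n → Set
    adj?    : (u v : Fin n) → Dec (Adj u v)
    sym     : ∀ {u v} → Adj u v → Adj v u
    irrefl  : ∀ {u} → ¬ Adj u u
open Graph public

module _ {n : ℕ} (G : Graph n) where

  data Reach : Fin n → Fin n → Set where
    here  : ∀ {u} → Reach u u
    step  : ∀ {u v w} → Adj G u v → Reach v w → Reach u w

  Connected : Set
  Connected = ∀ u v → Reach u v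

  Cubic : Set
  Cubic = ∀ v → ∃[ a ] ∃[ b ] ∃[ c ]
            (a ≢ b × a ≢ c × b ≢ c ×
             Adj G v a × Adj G v b × Adj G v c ×
             (∀ w → Adj G v w → (w ≡ a ⊎ w ≡ b ⊎ w ≡ c)))

  InClosedNbhd : Fin n → Fin n → Set
  InClosedNbhd u v = u ≡ v ⊎ Adj G v u

  -- S ⊆ V(G) (given by its characteristic function) is a self-identifying code:
  -- for every x, N_S[x] ≠ ∅ and ⋂_{v ∈ N_S[x]} N[v] = {x}.
  -- (x lies in every N[v] with v ∈ N[x], so the intersection equals {x}
  -- iff every z in it is x.)
  IsSIC : (Fin n → Bool) → Set
  IsSIC S = ∀ x →
    (∃[ v ] (S v ≡ true × InClosedNbhd v x)) ×
    (∀ z → (∀ v → S v ≡ true → InClosedNbhd v x → InClosedNbhd z v) → z ≡ x)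

  HasSIC : Set
  HasSIC = ∃[ S ] IsSIC S

  InBall2 : Fin n → Fin n → Set
  InBall2 x y = x ≡ y ⊎ Adj G x y ⊎ ∃[ m ] (Adj G x m × Adj G m y)

  AdjToTriangle : Fin n → Set
  AdjToTriangle v = ∃[ a ] ∃[ b ] ∃[ c ]
    (Adj G a b × Adj G b c × Adj G a c ×
     v ≢ a × v ≢ b × v ≢ c × Adj G v a)

  IsTwin : Fin n → Set
  IsTwin y = ∃[ y' ] (y' ≢ y ×
    ((∀ u → InClosedNbhd u y' → InClosedNbhd u y) ×
     (∀ u → InClosedNbhd u y → InClosedNbhd u y')
     ⊎
     (∀ u → Adj G y' u → Adj G y u) ×
     (∀ u → Adj G y u → Adj G y' u)))

-- If x is not a twin, y = x. Otherwise x has an open twin x', because a self-identifying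
-- code separates closed twins. In a cubic graph the code also forbids an edge pq with two
-- common neighbours (p and q would be closed twins); consequently a vertex on a triangle is
-- not a twin, and any two triangles through a vertex share another vertex. Since x is not
-- adjacent to a triangle, N(x) = {a, b, c} is independent and each neighbour u of x has
-- N(u) = {x, x', u'}. If a, b, c have the same third neighbour w, then {x, x', w, a, b, c}
-- is a K₃,₃ component, impossible for n ≥ 7. Otherwise some u' is adjacent to no other
-- neighbour of x: then u is not a twin, and y = u works when u' lies on no triangle, while
-- y = u' works when it does.
module Submission where

open import Defs
open import Data.Nat using (ℕ; _≤_; _<_)
open import Data.Nat.Properties using (≤-trans; n≤1+n; <⇒≱; 1+n≰n)
open import Data.Fin using (Fin; _≟_)
open import Data.Fin.Properties using (any?; all?; injective⇒≤)
open import Data.Bool using (Bool; true)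
open import Data.Empty using (⊥)
open import Data.Product using (Σ; ∃-syntax; _×_; _,_; proj₂)
open import Data.Sum using (_⊎_; inj₁; inj₂; swap)
open import Data.Vec using (Vec; []; _∷_; lookup; _++_)
open import Data.Vec.Relation.Unary.All as All using (All; []; _∷_)
open import Data.Vec.Relation.Unary.Any using (here; there; index)
open import Data.Vec.Relation.Unary.Any.Properties using (lookup-index)
open import Data.Vec.Relation.Unary.Unique.Propositional using (Unique; []; _∷_)
open import Data.Vec.Relation.Unary.Unique.Propositional.Properties using (lookup-injective)
open import Data.Vec.Membership.Propositional using (_∈_; _∉_; find)
open import Data.Vec.Membership.Propositional.Properties using (∈-lookup; ∈-++⁺ˡ; ∈-++⁺ʳ)
import Data.Vec.Membership.DecPropositional as DecMembership
open import Function.Definitions using (Injective)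
open import Relation.Nullary using (¬_; Dec; yes; no; contradiction)
open import Relation.Nullary.Decidable using (_×-dec_; _⊎-dec_; _→-dec_; ¬?; toSum)
open import Relation.Binary.PropositionalEquality using (_≡_; _≢_; refl; trans; subst; cong; ≢-sym)
import Relation.Binary.PropositionalEquality as ≡
open ≡.≡-Reasoning

module _ {a} {A : Set a} where

  injection-into-Vec⇒≤ : ∀ {m k} {ys : Vec A k} {f : Fin m → A} →
                         Injective _≡_ _≡_ f → (∀ i → f i ∈ ys) → m ≤ k
  injection-into-Vec⇒≤ {ys = ys} {f} f-injective f∈ys = injective⇒≤ index-injective
    where
    index-injective : Injective _≡_ _≡_ (λ i → index (f∈ys i))
    index-injective {i} {j} eq = f-injective (begin
      f i                         ≡⟨ lookup-index (f∈ys i) ⟩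
      lookup ys (index (f∈ys i))  ≡⟨ cong (lookup ys) eq ⟩
      lookup ys (index (f∈ys j))  ≡⟨ ≡.sym (lookup-index (f∈ys j)) ⟩
      f j                         ∎)

  unique-⊆⇒≤ : ∀ {m k} {xs : Vec A m} {ys : Vec A k} →
               Unique xs → (∀ {x} → x ∈ xs → x ∈ ys) → m ≤ k
  unique-⊆⇒≤ {xs = xs} xs-unique xs⊆ys =
    injection-into-Vec⇒≤ (lookup-injective xs-unique _ _) (λ i → xs⊆ys (∈-lookup i xs))

  unique₃ : ∀ {x y z : A} → x ≢ y → x ≢ z → y ≢ z → Unique (x ∷ y ∷ z ∷ [])
  unique₃ x≢y x≢z y≢z = (x≢y ∷ x≢z ∷ []) ∷ (y≢z ∷ []) ∷ [] ∷ []

covering-Vec⇒≤ : ∀ {n k} {ys : Vec (Fin n) k} → (∀ v → v ∈ ys) → n ≤ k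
covering-Vec⇒≤ = injection-into-Vec⇒≤ (λ eq → eq)

module _ {n : ℕ} (G : Graph n) where

  private
    _~_ : Fin n → Fin n → Set
    _~_ = Adj G
    open DecMembership (_≟_ {n}) using (_∈?_)

  adj⇒≢ : ∀ {u v} → u ~ v → u ≢ v
  adj⇒≢ u~u refl = irrefl G u~u

  reach-preserves : (P : Fin n → Set) → (∀ {u v} → u ~ v → P u → P v) →
                    ∀ {u v} → Reach G u v → P u → P v
  reach-preserves P closed here         Pu = Pu
  reach-preserves P closed (step u~w r) Pu = reach-preserves P closed r (closed u~w Pu)

  OnTriangle : Fin n → Set
  OnTriangle a = ∃[ b ] ∃[ c ] (a ~ b × a ~ c × b ~ c)

  OnTriangle? : ∀ a → Dec (OnTriangle a)
  OnTriangle? a = any? λ b → any? λ c → adj? G a b ×-dec adj? G a c ×-dec adj? G b c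

  OnTriangleAvoiding : Fin n → Fin n → Set
  OnTriangleAvoiding y a = ∃[ b ] ∃[ c ] ((a ~ b × a ~ c × b ~ c) × y ≢ b × y ≢ c)

  ¬OnTriangle⇒¬OnTriangleAvoiding : ∀ {y a} → ¬ OnTriangle a → ¬ OnTriangleAvoiding y a
  ¬OnTriangle⇒¬OnTriangleAvoiding ¬△ (b , c , △ , _) = ¬△ (b , c , △)

  ¬AdjToTriangle⁺ : ∀ {y} → (∀ {a} → y ~ a → ¬ OnTriangleAvoiding y a) → ¬ AdjToTriangle G y
  ¬AdjToTriangle⁺ ¬avoiding (a , b , c , a~b , b~c , a~c , _ , y≢b , y≢c , y~a) =
    ¬avoiding y~a (b , c , (a~b , a~c , b~c) , y≢b , y≢c)

  IsTwin? : ∀ y → Dec (IsTwin G y)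
  IsTwin? y = any? λ z → ¬? (z ≟ y) ×-dec
    ((all? (λ u → N[ z ]? u →-dec N[ y ]? u) ×-dec all? (λ u → N[ y ]? u →-dec N[ z ]? u))
     ⊎-dec
     (all? (λ u → adj? G z u →-dec adj? G y u) ×-dec all? (λ u → adj? G y u →-dec adj? G z u)))
    where
    N[_]? : ∀ v u → Dec (InClosedNbhd G u v)
    N[ v ]? u = u ≟ v ⊎-dec adj? G v u

  module _ {S : Fin n → Bool} (sic : IsSIC G S) where

    closedNbhd-⊆⇒≡ : ∀ {y z} → (∀ u → InClosedNbhd G u y → InClosedNbhd G u z) → z ≡ y
    closedNbhd-⊆⇒≡ {y} {z} N[y]⊆N[z] = proj₂ (sic y) z z∈N[v]
      where
      z∈N[v] : ∀ v → S v ≡ true → InClosedNbhd G v y → InClosedNbhd G z v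
      z∈N[v] v _ v∈N[y] with N[y]⊆N[z] v v∈N[y]
      ... | inj₁ v≡z = inj₁ (≡.sym v≡z)
      ... | inj₂ z~v = inj₂ (sym G z~v)

    ¬IsTwin⁺ : ∀ {y} → (∀ {z} → z ≢ y → (∀ {u} → y ~ u → z ~ u) → ⊥) → ¬ IsTwin G y
    ¬IsTwin⁺ _ (z , z≢y , inj₁ (_ , N[y]⊆N[z])) = z≢y (closedNbhd-⊆⇒≡ N[y]⊆N[z])
    ¬IsTwin⁺ no-open-twin (z , z≢y , inj₂ (_ , N[y]⊆N[z])) = no-open-twin z≢y (N[y]⊆N[z] _)

  module _ (cubic : Cubic G) where

    nbhd : ∀ v → Σ (Vec (Fin n) 3) λ ns → Unique ns × All (v ~_) ns × (∀ {w} → v ~ w → w ∈ ns)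
    nbhd v with cubic v
    ... | a , b , c , a≢b , a≢c , b≢c , v~a , v~b , v~c , exhaust =
      a ∷ b ∷ c ∷ [] , unique₃ a≢b a≢c b≢c , v~a ∷ v~b ∷ v~c ∷ [] , λ v~w → ⊎⇒∈ (exhaust _ v~w)
      where
      ⊎⇒∈ : ∀ {w} → w ≡ a ⊎ w ≡ b ⊎ w ≡ c → w ∈ a ∷ b ∷ c ∷ []
      ⊎⇒∈ (inj₁ w≡a)        = here w≡a
      ⊎⇒∈ (inj₂ (inj₁ w≡b)) = there (here w≡b)
      ⊎⇒∈ (inj₂ (inj₂ w≡c)) = there (there (here w≡c))

    distinct-neighbours≤3 : ∀ {v m} {ws : Vec (Fin n) m} → Unique ws → All (v ~_) ws → m ≤ 3
    distinct-neighbours≤3 {v} ws-unique v~ws with nbhd v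
    ... | _ , _ , _ , exhaust = unique-⊆⇒≤ ws-unique (λ w∈ws → exhaust (All.lookup v~ws w∈ws))

    three-neighbours-exhaust : ∀ {v a b c} → Unique (a ∷ b ∷ c ∷ []) → All (v ~_) (a ∷ b ∷ c ∷ []) →
                               ∀ {w} → v ~ w → w ∈ a ∷ b ∷ c ∷ []
    three-neighbours-exhaust {a = a} {b} {c} abc-unique v~abc {w} v~w
      with All.decide (λ u → swap (toSum (w ≟ u))) (a ∷ b ∷ c ∷ [])
    ... | inj₂ w∈abc = w∈abc
    ... | inj₁ w≢abc =
      contradiction (distinct-neighbours≤3 (w≢abc ∷ abc-unique) (v~w ∷ v~abc)) 1+n≰n

    neighbour-outside : ∀ v s t → ∃[ r ] (v ~ r × r ∉ s ∷ t ∷ [])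
    neighbour-outside v s t with nbhd v
    ... | ns , ns-unique , v~ns , _ with All.decide (λ r → toSum (r ∈? s ∷ t ∷ [])) ns
    ... | inj₂ some∉st = let r , r∈ns , r∉st = find some∉st in r , All.lookup v~ns r∈ns , r∉st
    ... | inj₁ ns⊆st =
      contradiction (unique-⊆⇒≤ ns-unique (All.lookup ns⊆st)) 1+n≰n

    module _ {S : Fin n → Bool} (sic : IsSIC G S) where

      no-diamond : ∀ {p q s t} → p ~ q → p ~ s → p ~ t → q ~ s → q ~ t → s ≢ t → ⊥
      no-diamond {p} {q} {s} {t} p~q p~s p~t q~s q~t s≢t =
        adj⇒≢ p~q (closedNbhd-⊆⇒≡ sic N[q]⊆N[p])
        where
        N[q]⊆N[p] : ∀ u → InClosedNbhd G u q → InClosedNbhd G u p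
        N[q]⊆N[p] u (inj₁ refl) = inj₂ p~q
        N[q]⊆N[p] u (inj₂ q~u)
          with three-neighbours-exhaust (unique₃ (adj⇒≢ p~s) (adj⇒≢ p~t) s≢t)
                                        (sym G p~q ∷ q~s ∷ q~t ∷ []) q~u
        ... | here refl                 = inj₁ refl
        ... | there (here refl)         = inj₂ p~s
        ... | there (there (here refl)) = inj₂ p~t

      OnTriangle⇒¬IsTwin : ∀ {v} → OnTriangle v → ¬ IsTwin G v
      OnTriangle⇒¬IsTwin (p , q , v~p , v~q , p~q) = ¬IsTwin⁺ sic λ z≢v N[v]⊆N[z] →
        no-diamond p~q (sym G v~p) (sym G (N[v]⊆N[z] v~p)) (sym G v~q) (sym G (N[v]⊆N[z] v~q))
                   (≢-sym z≢v)

      -- Two triangles through p sharing the edge pq form a diamond; otherwise p has 4 neighbours.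
      triangle⇒¬OnTriangleAvoiding : ∀ {v p q} → v ~ p → v ~ q → p ~ q → ¬ OnTriangleAvoiding v p
      triangle⇒¬OnTriangleAvoiding {v} {p} {q} v~p v~q p~q (b , c , (p~b , p~c , b~c) , v≢b , v≢c)
        with b ≟ q | c ≟ q
      ... | yes refl | _        = no-diamond p~q (sym G v~p) p~c (sym G v~q) b~c v≢c
      ... | no _     | yes refl = no-diamond p~q (sym G v~p) p~b (sym G v~q) (sym G b~c) v≢b
      ... | no b≢q   | no c≢q
        with three-neighbours-exhaust (unique₃ (adj⇒≢ v~q) v≢b (≢-sym b≢q))
                                      (sym G v~p ∷ p~q ∷ p~b ∷ []) p~c
      ...   | here c≡v                 = v≢c (≡.sym c≡v)
      ...   | there (here c≡q)         = c≢q c≡q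
      ...   | there (there (here c≡b)) = adj⇒≢ b~c (≡.sym c≡b)

      module OpenTwins {x x' : Fin n} (x≁△ : ¬ AdjToTriangle G x) (x'≢x : x' ≢ x)
                       (N[x']⊆N[x] : ∀ u → x' ~ u → x ~ u) (N[x]⊆N[x'] : ∀ u → x ~ u → x' ~ u) where

        Goal : Set
        Goal = ∃[ y ] (InBall2 G x y × ¬ AdjToTriangle G y × ¬ IsTwin G y)

        -- An edge pq inside N(x) = N(x') would give the triangle p q x' next to x.
        N[x]-independent : ∀ {p q} → x ~ p → x ~ q → ¬ p ~ q
        N[x]-independent {p} {q} x~p x~q p~q =
          x≁△ (p , q , x' , p~q , sym G (N[x]⊆N[x'] q x~q) , sym G (N[x]⊆N[x'] p x~p) ,
               adj⇒≢ x~p , adj⇒≢ x~q , ≢-sym x'≢x , x~p)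

        ¬OnTriangle-x : ¬ OnTriangle x
        ¬OnTriangle-x (p , q , x~p , x~q , p~q) = N[x]-independent x~p x~q p~q

        ¬OnTriangle-x' : ¬ OnTriangle x'
        ¬OnTriangle-x' (p , q , x'~p , x'~q , p~q) =
          N[x]-independent (N[x']⊆N[x] p x'~p) (N[x']⊆N[x] q x'~q) p~q

        N[x]-¬OnTriangle : ∀ {u} → x ~ u → ¬ OnTriangle u
        N[x]-¬OnTriangle {u} x~u (b , c , u~b , u~c , b~c) with x ≟ b | x ≟ c
        ... | yes refl | _        = N[x]-independent x~u b~c u~c
        ... | no _     | yes refl = N[x]-independent x~u (sym G b~c) u~b
        ... | no x≢b   | no x≢c   = x≁△ (u , b , c , u~b , b~c , u~c , adj⇒≢ x~u , x≢b , x≢c , x~u)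

        record ThirdNeighbour (u : Fin n) : Set where
          field
            third    : Fin n
            u~third  : u ~ third
            x≢third  : x ≢ third
            x'≢third : x' ≢ third
            nbhd⊆    : ∀ {w} → u ~ w → w ∈ x ∷ x' ∷ third ∷ []
        open ThirdNeighbour

        thirdNeighbour : ∀ {u} → x ~ u → ThirdNeighbour u
        thirdNeighbour {u} x~u with neighbour-outside u x x'
        ... | r , u~r , r∉ = record
          { third    = r
          ; u~third  = u~r
          ; x≢third  = x≢r
          ; x'≢third = x'≢r
          ; nbhd⊆    = three-neighbours-exhaust (unique₃ (≢-sym x'≢x) x≢r x'≢r)
                         (sym G x~u ∷ sym G (N[x]⊆N[x'] u x~u) ∷ u~r ∷ [])
          }
          where
          x≢r : x ≢ r
          x≢r x≡r = r∉ (here (≡.sym x≡r))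
          x'≢r : x' ≢ r
          x'≢r x'≡r = r∉ (there (here (≡.sym x'≡r)))

        third-unique : ∀ {v w} (tv : ThirdNeighbour v) → v ~ w → x ≢ w → x' ≢ w → w ≡ third tv
        third-unique tv v~w x≢w x'≢w with nbhd⊆ tv v~w
        ... | here w≡x                 = contradiction (≡.sym w≡x) x≢w
        ... | there (here w≡x')        = contradiction (≡.sym w≡x') x'≢w
        ... | there (there (here w≡r)) = w≡r

        off-triangle-third⇒goal : ∀ {u} → x ~ u → (tu : ThirdNeighbour u) →
                                  (∀ {v} → x ~ v → v ~ third tu → v ≡ u) → ¬ OnTriangle (third tu) → Goal
        off-triangle-third⇒goal {u} x~u tu third-private ¬△ =
          u , inj₂ (inj₁ x~u) ,
          ¬AdjToTriangle⁺ (λ u~a → ¬OnTriangle⇒¬OnTriangleAvoiding (N[u]-¬△ u~a)) ,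
          ¬IsTwin⁺ sic (λ z≢u N[u]⊆N[z] →
            z≢u (third-private (sym G (N[u]⊆N[z] (sym G x~u))) (N[u]⊆N[z] (u~third tu))))
          where
          N[u]-¬△ : ∀ {a} → u ~ a → ¬ OnTriangle a
          N[u]-¬△ u~a with nbhd⊆ tu u~a
          ... | here refl                 = ¬OnTriangle-x
          ... | there (here refl)         = ¬OnTriangle-x'
          ... | there (there (here refl)) = ¬△

        on-triangle-third⇒goal : ∀ {u} → x ~ u → (tu : ThirdNeighbour u) → OnTriangle (third tu) → Goal
        on-triangle-third⇒goal {u} x~u tu △@(p , q , r~p , r~q , p~q) =
          r , inj₂ (inj₂ (u , x~u , u~r)) ,
          ¬AdjToTriangle⁺ (λ r~a → N[r]-¬avoiding (three-neighbours-exhaust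
            (unique₃ u≢p u≢q (adj⇒≢ p~q)) (sym G u~r ∷ r~p ∷ r~q ∷ []) r~a)) ,
          OnTriangle⇒¬IsTwin △
          where
          r : Fin n
          r = third tu
          u~r : u ~ r
          u~r = u~third tu
          u≢p : u ≢ p
          u≢p refl = N[x]-¬OnTriangle x~u (r , q , u~r , p~q , r~q)
          u≢q : u ≢ q
          u≢q refl = N[x]-¬OnTriangle x~u (r , p , u~r , sym G p~q , r~p)
          N[r]-¬avoiding : ∀ {a} → a ∈ u ∷ p ∷ q ∷ [] → ¬ OnTriangleAvoiding r a
          N[r]-¬avoiding (here refl)                 = ¬OnTriangle⇒¬OnTriangleAvoiding (N[x]-¬OnTriangle x~u)
          N[r]-¬avoiding (there (here refl))         = triangle⇒¬OnTriangleAvoiding r~p r~q p~q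
          N[r]-¬avoiding (there (there (here refl))) = triangle⇒¬OnTriangleAvoiding r~q r~p (sym G p~q)

        private-third⇒goal : ∀ {u v w} → Unique (u ∷ v ∷ w ∷ []) → All (x ~_) (u ∷ v ∷ w ∷ []) →
                             (tu : ThirdNeighbour u) (tv : ThirdNeighbour v) (tw : ThirdNeighbour w) →
                             third tu ≢ third tv → third tu ≢ third tw → Goal
        private-third⇒goal {u} uvw-unique x~uvw@(x~u ∷ _) tu tv tw ru≢rv ru≢rw
          with OnTriangle? (third tu)
        ... | yes △  = on-triangle-third⇒goal x~u tu △
        ... | no ¬△ = off-triangle-third⇒goal x~u tu third-private ¬△
          where
          third-private : ∀ {z} → x ~ z → z ~ third tu → z ≡ u
          third-private x~z z~ru with three-neighbours-exhaust uvw-unique x~uvw x~z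
          ... | here refl                 = refl
          ... | there (here refl)         =
            contradiction (third-unique tv z~ru (x≢third tu) (x'≢third tu)) ru≢rv
          ... | there (there (here refl)) =
            contradiction (third-unique tw z~ru (x≢third tu) (x'≢third tu)) ru≢rw

        common-neighbour⇒n≤6 : Connected G → ∀ {a b c w} → Unique (a ∷ b ∷ c ∷ []) →
                               All (x ~_) (a ∷ b ∷ c ∷ []) → All (_~ w) (a ∷ b ∷ c ∷ []) →
                               x ≢ w → x' ≢ w → n ≤ 6
        common-neighbour⇒n≤6 conn {a} {b} {c} {w} abc-unique x~abc abc~w x≢w x'≢w =
          covering-Vec⇒≤ (λ v → reach-preserves (_∈ K₃,₃) closed (conn x v) (here refl))
          where
          K₃,₃ : Vec (Fin n) 6
          K₃,₃ = (x ∷ x' ∷ w ∷ []) ++ (a ∷ b ∷ c ∷ [])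
          N[x]⊆ : ∀ {v} → x ~ v → v ∈ a ∷ b ∷ c ∷ []
          N[x]⊆ = three-neighbours-exhaust abc-unique x~abc
          N[abc]⊆ : ∀ {u v} → u ∈ a ∷ b ∷ c ∷ [] → u ~ v → v ∈ x ∷ x' ∷ w ∷ []
          N[abc]⊆ {u} u∈abc = three-neighbours-exhaust (unique₃ (≢-sym x'≢x) x≢w x'≢w)
            (sym G x~u ∷ sym G (N[x]⊆N[x'] _ x~u) ∷ All.lookup abc~w u∈abc ∷ [])
            where
            x~u : x ~ u
            x~u = All.lookup x~abc u∈abc
          N[w]⊆ : ∀ {v} → w ~ v → v ∈ a ∷ b ∷ c ∷ []
          N[w]⊆ = three-neighbours-exhaust abc-unique (All.map (sym G) abc~w)
          closed : ∀ {u v} → u ~ v → u ∈ K₃,₃ → v ∈ K₃,₃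
          closed u~v (here refl)                   = ∈-++⁺ʳ (x ∷ x' ∷ w ∷ []) (N[x]⊆ u~v)
          closed u~v (there (here refl))           = ∈-++⁺ʳ (x ∷ x' ∷ w ∷ []) (N[x]⊆ (N[x']⊆N[x] _ u~v))
          closed u~v (there (there (here refl)))   = ∈-++⁺ʳ (x ∷ x' ∷ w ∷ []) (N[w]⊆ u~v)
          closed u~v (there (there (there u∈abc))) = ∈-++⁺ˡ (N[abc]⊆ u∈abc u~v)

        goal : Connected G → 6 < n → Goal
        goal conn 6<n with nbhd x
        ... | a ∷ b ∷ c ∷ [] , (a≢b ∷ a≢c ∷ []) ∷ (b≢c ∷ []) ∷ [] ∷ [] , x~a ∷ x~b ∷ x~c ∷ [] , _
          with thirdNeighbour x~a | thirdNeighbour x~b | thirdNeighbour x~c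
        ... | ta | tb | tc with third ta ≟ third tb | third ta ≟ third tc
        ... | no ra≢rb | no ra≢rc =
          private-third⇒goal (unique₃ a≢b a≢c b≢c) (x~a ∷ x~b ∷ x~c ∷ []) ta tb tc ra≢rb ra≢rc
        ... | yes ra≡rb | no ra≢rc =
          private-third⇒goal (unique₃ (≢-sym a≢c) (≢-sym b≢c) a≢b) (x~c ∷ x~a ∷ x~b ∷ []) tc ta tb
            (≢-sym ra≢rc) (λ rc≡rb → ra≢rc (trans ra≡rb (≡.sym rc≡rb)))
        ... | no ra≢rb | yes ra≡rc =
          private-third⇒goal (unique₃ (≢-sym a≢b) b≢c a≢c) (x~b ∷ x~a ∷ x~c ∷ []) tb ta tc
            (≢-sym ra≢rb) (λ rb≡rc → ra≢rb (trans ra≡rc (≡.sym rb≡rc)))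
        ... | yes ra≡rb | yes ra≡rc = contradiction
          (common-neighbour⇒n≤6 conn (unique₃ a≢b a≢c b≢c) (x~a ∷ x~b ∷ x~c ∷ []) abc~ra
                                (x≢third ta) (x'≢third ta))
          (<⇒≱ 6<n)
          where
          abc~ra : All (_~ third ta) (a ∷ b ∷ c ∷ [])
          abc~ra = u~third ta ∷ subst (b ~_) (≡.sym ra≡rb) (u~third tb)
                              ∷ subst (c ~_) (≡.sym ra≡rc) (u~third tc) ∷ []

mainTheorem7 : (n : ℕ) → 8 ≤ n → (G : Graph n) → Connected G → Cubic G → HasSIC G →
    (x : Fin n) → ¬ AdjToTriangle G x →
    ∃[ y ] (InBall2 G x y × ¬ AdjToTriangle G y × ¬ IsTwin G y)
mainTheorem7 n 8≤n G conn cubic (S , sic) x x≁△ with IsTwin? G x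
... | no ¬twin = x , inj₁ refl , x≁△ , ¬twin
... | yes (x' , x'≢x , inj₁ (_ , N[x]⊆N[x'])) = contradiction (closedNbhd-⊆⇒≡ G sic N[x]⊆N[x']) x'≢x
... | yes (x' , x'≢x , inj₂ (N[x']⊆N[x] , N[x]⊆N[x'])) =
  OpenTwins.goal G cubic sic x≁△ x'≢x N[x']⊆N[x] N[x]⊆N[x'] conn (≤-trans (n≤1+n 7) 8≤n)
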